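{- Every complete theory in a countable relational language is an ALU-theory or is ALU-approximable.
   Context: A theory $T$ in a relational language $\Sigma$ is almost language uniform (an ALU-theory) if for each arity $n$ such that $\Sigma$ contains $n$-ary predicate symbols there is a partition of the $n$-ary predicate symbols of $\Sigma$ into finitely many classes such that any substitution of predicate symbols preserving these classes preserves $T$. For a class $\mathcal{T}$ and a theory $T\notin\mathcal{T}$, $T$ is $\mathcal{T}$-approximable if for every sentence $\varphi\in T$ there is $T'\in\mathcal{T}$ with $\varphi\in T'$. A theory is ALU-approximable if it is $\mathcal{T}$-approximable for some family $\mathcal{T}$ consisting of ALU-theories. -}

module Defs where

open import Level using (Level; 0ℓ) renaming (suc to lsuc)
open import Data.Nat using (ℕ; suc)
open import Data.Fin using (Fin; zero; suc)
open import Data.Vec using (Vec; map)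
open import Data.Product using (Σ; _×_; _,_)
open import Data.Empty using (⊥)
open import Relation.Nullary using (¬_)
open import Relation.Binary.PropositionalEquality using (_≡_)
open import Function.Bundles using (_↣_; _⤖_; Bijection)

-- Relational languages (first-order, with equality, no function or
-- constant symbols).  Pred n is the type of n-ary predicate symbols.

record Language : Set₁ where
  field
    Pred : ℕ → Set

open Language public

Countable : Language → Set
Countable L = Σ ℕ (Pred L) ↣ ℕ

-- First-order formulas with n free variables (de Bruijn indices).
-- ¬, ∧, ∃ together with atomic formulas form a complete set of
-- connectives for classical first-order logic.

data Formula (L : Language) : ℕ → Set where
  rel  : ∀ {n k} → Pred L k → Vec (Fin n) k → Formula L n
  equ  : ∀ {n} → Fin n → Fin n → Formula L n
  neg  : ∀ {n} → Formula L n → Formula L n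
  conj : ∀ {n} → Formula L n → Formula L n → Formula L n
  ex   : ∀ {n} → Formula L (suc n) → Formula L n

Sentence : Language → Set
Sentence L = Formula L 0

Theory : Language → Set₁
Theory L = Sentence L → Set

_≐_ : ∀ {L} → Theory L → Theory L → Set
T ≐ T′ = ∀ φ → (T φ → T′ φ) × (T′ φ → T φ)

record Structure (L : Language) : Set₁ where
  field
    Carrier  : Set
    nonempty : Carrier
    interp   : ∀ {k} → Pred L k → Vec Carrier k → Set

open Structure public

extend : ∀ {A : Set} {n} → A → (Fin n → A) → Fin (suc n) → A
extend a ρ zero    = a
extend a ρ (suc i) = ρ i

Sat : ∀ {L} (M : Structure L) {n} → Formula L n → (Fin n → Carrier M) → Set
Sat M (rel P xs) ρ = interp M P (map ρ xs)
Sat M (equ i j)  ρ = ρ i ≡ ρ j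
Sat M (neg φ)    ρ = ¬ Sat M φ ρ
Sat M (conj φ ψ) ρ = Sat M φ ρ × Sat M ψ ρ
Sat M (ex φ)     ρ = Σ (Carrier M) λ a → Sat M φ (extend a ρ)

emptyEnv : ∀ {A : Set} → Fin 0 → A
emptyEnv ()

_⊨_ : ∀ {L} → Structure L → Sentence L → Set
M ⊨ φ = Sat M φ emptyEnv

Th : ∀ {L} → Structure L → Theory L
Th M φ = M ⊨ φ

IsComplete : ∀ {L} → Theory L → Set₁
IsComplete {L} T = Σ (Structure L) λ M → T ≐ Th M

Substitution : Language → Set
Substitution L = ∀ n → Pred L n ⤖ Pred L n

applySubst : ∀ {L} → Substitution L → ∀ {n} → Formula L n → Formula L n
applySubst σ (rel {k = k} P xs) = rel (Bijection.to (σ k) P) xs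
applySubst σ (equ i j)  = equ i j
applySubst σ (neg φ)    = neg (applySubst σ φ)
applySubst σ (conj φ ψ) = conj (applySubst σ φ) (applySubst σ ψ)
applySubst σ (ex φ)     = ex (applySubst σ φ)

Preserves : ∀ {L} → Substitution L → Theory L → Set
Preserves σ T = ∀ φ → T φ → T (applySubst σ φ)

-- Almost language uniform theories: for each arity n a partition of
-- the n-ary symbols into finitely many (k n) classes, given by a
-- class-assignment map, such that every class-preserving substitution
-- preserves T.  (For arities with no symbols the choice is vacuous.)

IsALU : ∀ {L} → Theory L → Set
IsALU {L} T =
  Σ (ℕ → ℕ) λ k →
  Σ (∀ n → Pred L n → Fin (k n)) λ cls →
    ∀ (σ : Substitution L) →
      (∀ n (P : Pred L n) → cls n (Bijection.to (σ n) P) ≡ cls n P) →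
      Preserves σ T

Approximable : ∀ {L} → (Theory L → Set₁) → Theory L → Set₁
Approximable {L} 𝒯 T =
  (∀ T′ → 𝒯 T′ → ¬ (T ≐ T′)) ×
  (∀ φ → T φ → Σ (Theory L) λ T′ → 𝒯 T′ × T′ φ)

IsALUApproximable : ∀ {L} → Theory L → Set₂
IsALUApproximable {L} T =
  Σ (Theory L → Set₁) λ 𝒯 →
    (∀ T′ → 𝒯 T′ → IsComplete T′ × IsALU T′) ×
    Approximable 𝒯 T

module Submission where

-- Fix an injective coding of the predicate symbols by natural numbers.
-- For a bound B, the B-truncation of M keeps the interpretation of the
-- symbols with code ≤ B and interprets every other symbol as empty.
--   * The theory of a truncation is ALU: give each of the finitely many
--     symbols with code ≤ B its own class and put all remaining symbols
--     into one further class.  A class-preserving substitution fixes the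
--     small symbols and permutes the (all empty) large ones, so it is a
--     symmetry of the truncation, and symmetries preserve the theory.
--   * A sentence φ only mentions symbols with code ≤ bound φ, and the
--     truncation agrees with M on those symbols, so φ ∈ Th M implies
--     that φ holds in the (bound φ)-truncation.
-- By excluded middle either T is ALU, or no complete ALU theory equals T
-- and the theories of the truncations approximate T.

open import Defs
open import Level using (0ℓ; Lift; lift) renaming (suc to lsuc)
open import Axiom.ExcludedMiddle using (ExcludedMiddle)
open import Data.Nat using (ℕ; suc; _≤_; _⊔_; _≤?_; s≤s)
open import Data.Nat.Properties using (≤-trans; ≤-refl; m≤m⊔n; m≤n⊔m)
import Data.Nat.Properties as ℕₚ
open import Data.Fin using (Fin; fromℕ<) renaming (zero to fzero; suc to fsuc)
open import Data.Fin.Properties using (fromℕ<-injective) renaming (suc-injective to fsuc-injective)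
open import Data.Vec using (Vec)
open import Data.Sum using (_⊎_; inj₁; inj₂)
open import Data.Product using (Σ; _×_; _,_; proj₁; proj₂)
open import Data.Product.Properties using (,-injectiveʳ-UIP)
open import Data.Product.Function.NonDependent.Propositional using (_×-⇔_)
import Data.Product.Function.Dependent.Propositional as Σ
open import Data.Unit using (⊤; tt)
open import Data.Empty using (⊥-elim)
open import Relation.Nullary using (¬_; yes; no)
open import Relation.Binary.PropositionalEquality using (_≡_; refl; sym; subst)
open import Function.Bundles using (_⇔_; mk⇔; Equivalence; Bijection; Injection)
open import Function.Construct.Identity using (⇔-id)
open import Function.Related.TypeIsomorphisms using (¬-cong-⇔)
open import Function.Related.Propositional using (equivalence)

SymbolSet : Language → Set₁
SymbolSet L = ∀ {k} → Pred L k → Set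

UsesOnly : ∀ {L} → SymbolSet L → ∀ {n} → Formula L n → Set
UsesOnly S (rel P xs) = S P
UsesOnly S (equ i j)  = ⊤
UsesOnly S (neg ψ)    = UsesOnly S ψ
UsesOnly S (conj ψ χ) = UsesOnly S ψ × UsesOnly S χ
UsesOnly S (ex ψ)     = UsesOnly S ψ

usesOnly-mono : ∀ {L} {S S′ : SymbolSet L} → (∀ {k} (P : Pred L k) → S P → S′ P) →
                ∀ {n} (ψ : Formula L n) → UsesOnly S ψ → UsesOnly S′ ψ
usesOnly-mono S⊆S′ (rel P xs) s       = S⊆S′ P s
usesOnly-mono S⊆S′ (equ i j)  s       = tt
usesOnly-mono S⊆S′ (neg ψ)    s       = usesOnly-mono S⊆S′ ψ s
usesOnly-mono S⊆S′ (conj ψ χ) (s , t) = usesOnly-mono S⊆S′ ψ s , usesOnly-mono S⊆S′ χ t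
usesOnly-mono S⊆S′ (ex ψ)     s       = usesOnly-mono S⊆S′ ψ s

reinterpret : ∀ {L} (M : Structure L) → (∀ {k} → Pred L k → Vec (Carrier M) k → Set) →
              Structure L
reinterpret M I = record { Carrier = Carrier M ; nonempty = nonempty M ; interp = I }

sat-cong : ∀ {L} (M : Structure L) (I : ∀ {k} → Pred L k → Vec (Carrier M) k → Set)
           {S : SymbolSet L} →
           (∀ {k} (P : Pred L k) → S P → ∀ xs → interp M P xs ⇔ I P xs) →
           ∀ {n} (ψ : Formula L n) → UsesOnly S ψ → (ρ : Fin n → Carrier M) →
           Sat M ψ ρ ⇔ Sat (reinterpret M I) ψ ρ
sat-cong M I agree (rel P xs) s       ρ = agree P s _
sat-cong M I agree (equ i j)  s       ρ = ⇔-id _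
sat-cong M I agree (neg ψ)    s       ρ = ¬-cong-⇔ (sat-cong M I agree ψ s ρ)
sat-cong M I agree (conj ψ χ) (s , t) ρ = sat-cong M I agree ψ s ρ ×-⇔ sat-cong M I agree χ t ρ
sat-cong M I agree (ex ψ)     s       ρ =
  Σ.congˡ {k = equivalence} λ {a} → sat-cong M I agree ψ s (extend a ρ)

IsSymmetry : ∀ {L} → Structure L → Substitution L → Set
IsSymmetry {L} M σ = ∀ {k} (P : Pred L k) xs → interp M (Bijection.to (σ k) P) xs ⇔ interp M P xs

sat-symmetry : ∀ {L} (M : Structure L) (σ : Substitution L) → IsSymmetry M σ →
               ∀ {n} (ψ : Formula L n) (ρ : Fin n → Carrier M) →
               Sat M (applySubst σ ψ) ρ ⇔ Sat M ψ ρ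
sat-symmetry M σ sym-σ (rel P xs) ρ = sym-σ P _
sat-symmetry M σ sym-σ (equ i j)  ρ = ⇔-id _
sat-symmetry M σ sym-σ (neg ψ)    ρ = ¬-cong-⇔ (sat-symmetry M σ sym-σ ψ ρ)
sat-symmetry M σ sym-σ (conj ψ χ) ρ = sat-symmetry M σ sym-σ ψ ρ ×-⇔ sat-symmetry M σ sym-σ χ ρ
sat-symmetry M σ sym-σ (ex ψ)     ρ =
  Σ.congˡ {k = equivalence} λ {a} → sat-symmetry M σ sym-σ ψ (extend a ρ)

symmetry-preserves-Th : ∀ {L} (M : Structure L) (σ : Substitution L) → IsSymmetry M σ →
                        Preserves σ (Th M)
symmetry-preserves-Th M σ sym-σ φ = Equivalence.from (sat-symmetry M σ sym-σ φ emptyEnv)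

Th-IsComplete : ∀ {L} (M : Structure L) → IsComplete (Th M)
Th-IsComplete M = M , λ φ → (λ x → x) , (λ x → x)

IsALU-resp-≐ : ∀ {L} {T T′ : Theory L} → T ≐ T′ → IsALU T′ → IsALU T
IsALU-resp-≐ T≐T′ (k , cls , pres) =
  k , cls , λ σ σ-cls φ t → proj₂ (T≐T′ _) (pres σ σ-cls φ (proj₁ (T≐T′ φ) t))

classOf : (B c : ℕ) → Fin (suc (suc B))
classOf B c with c ≤? B
... | yes c≤B = fsuc (fromℕ< (s≤s c≤B))
... | no  _   = fzero

classOf-small : ∀ {B c d} → classOf B c ≡ classOf B d → c ≤ B → c ≡ d
classOf-small {B} {c} {d} same c≤B with c ≤? B | d ≤? B
... | yes p | yes q = fromℕ<-injective c d (s≤s p) (s≤s q) (fsuc-injective same)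
... | yes p | no  q with () ← same
... | no  p | _     = ⊥-elim (p c≤B)

module Coding {L : Language} (coding : Countable L) where

  code : ∀ {k} → Pred L k → ℕ
  code {k} P = Injection.to coding (k , P)

  -- The arity is fixed, so equal codes give equal symbols (ℕ has UIP).
  code-injective : ∀ {k} {P Q : Pred L k} → code P ≡ code Q → P ≡ Q
  code-injective e = ,-injectiveʳ-UIP ℕₚ.≡-irrelevant (Injection.injective coding e)

  bound : ∀ {n} → Formula L n → ℕ
  bound (rel P xs) = code P
  bound (equ i j)  = 0
  bound (neg ψ)    = bound ψ
  bound (conj ψ χ) = bound ψ ⊔ bound χ
  bound (ex ψ)     = bound ψ

  Small : ℕ → SymbolSet L
  Small B P = code P ≤ B

  usesOnly-bound : ∀ {n} (ψ : Formula L n) → UsesOnly (Small (bound ψ)) ψ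
  usesOnly-bound (rel P xs) = ≤-refl
  usesOnly-bound (equ i j)  = tt
  usesOnly-bound (neg ψ)    = usesOnly-bound ψ
  usesOnly-bound (conj ψ χ) =
    usesOnly-mono (λ P s → ≤-trans s (m≤m⊔n _ _)) ψ (usesOnly-bound ψ) ,
    usesOnly-mono (λ P s → ≤-trans s (m≤n⊔m _ _)) χ (usesOnly-bound χ)
  usesOnly-bound (ex ψ)     = usesOnly-bound ψ

  truncate : Structure L → ℕ → Structure L
  truncate M B = reinterpret M (λ P xs → Small B P × interp M P xs)

  truncate-agrees : (M : Structure L) (B : ℕ) (φ : Sentence L) → UsesOnly (Small B) φ →
                    M ⊨ φ → truncate M B ⊨ φ
  truncate-agrees M B φ small =
    Equivalence.to (sat-cong M _ (λ P P-small xs → mk⇔ (P-small ,_) proj₂) φ small emptyEnv)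

  truncationClass : (B : ℕ) → ∀ n → Pred L n → Fin (suc (suc B))
  truncationClass B n P = classOf B (code P)

  module _ (B : ℕ) (σ : Substitution L)
           (σ-cls : ∀ n (P : Pred L n) →
                    truncationClass B n (Bijection.to (σ n) P) ≡ truncationClass B n P) where

    fixes-small : ∀ {k} (P : Pred L k) → Small B P → Bijection.to (σ k) P ≡ P
    fixes-small {k} P small = sym (code-injective (classOf-small (sym (σ-cls k P)) small))

    fixes-small-image : ∀ {k} (P : Pred L k) → Small B (Bijection.to (σ k) P) →
                        Bijection.to (σ k) P ≡ P
    fixes-small-image {k} P small = code-injective (classOf-small (σ-cls k P) small)

    truncate-symmetry : (M : Structure L) → IsSymmetry (truncate M B) σ
    truncate-symmetry M {k} P xs = mk⇔ from-image to-image
      where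
        Interp : Pred L k → Set
        Interp Q = Small B Q × interp M Q xs

        from-image : Interp (Bijection.to (σ k) P) → Interp P
        from-image i = subst Interp (fixes-small-image P (proj₁ i)) i

        to-image : Interp P → Interp (Bijection.to (σ k) P)
        to-image i = subst Interp (sym (fixes-small P (proj₁ i))) i

  truncate-ALU : (M : Structure L) (B : ℕ) → IsALU (Th (truncate M B))
  truncate-ALU M B = (λ _ → suc (suc B)) , truncationClass B , λ σ σ-cls →
    symmetry-preserves-Th (truncate M B) σ (truncate-symmetry B σ σ-cls M)

proposition5p1 : ExcludedMiddle (lsuc (lsuc 0ℓ)) →
    (L : Language) → Countable L → (T : Theory L) → IsComplete T →
    IsALU T ⊎ IsALUApproximable T
proposition5p1 lem L coding T (M , T≐ThM) with lem {Lift (lsuc (lsuc 0ℓ)) (IsALU T)}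
... | yes (lift T-alu) = inj₁ T-alu
... | no  T-not-alu    = inj₂ (CompleteALU , (λ T′ h → h) , excluded , covered)
  where
    open Coding coding

    CompleteALU : Theory L → Set₁
    CompleteALU T′ = IsComplete T′ × IsALU T′

    excluded : ∀ T′ → CompleteALU T′ → ¬ (T ≐ T′)
    excluded T′ (_ , T′-alu) T≐T′ = T-not-alu (lift (IsALU-resp-≐ T≐T′ T′-alu))

    covered : ∀ φ → T φ → Σ (Theory L) λ T′ → CompleteALU T′ × T′ φ
    covered φ φ∈T =
      Th (truncate M (bound φ)) ,
      (Th-IsComplete _ , truncate-ALU M (bound φ)) ,
      truncate-agrees M (bound φ) φ (usesOnly-bound φ) (proj₁ (T≐ThM φ) φ∈T)
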